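{- Let $A=\{a_1,a_2,\dots\}$ with $0\le a_1\le a_2\le\cdots$ and $B=\{b_1,b_2,\dots\}$ with $0\le b_1\le b_2\le\cdots$ be multisets of nonnegative integers (listed with multiplicity, each integer occurring only finitely often), and let $\underline{\alpha}=(\alpha_1,\dots,\alpha_s)$, $\underline{\beta}=(\beta_1,\dots,\beta_t)$ be vectors of positive integers with $\alpha_1\le\cdots\le\alpha_s$, $\beta_1\le\cdots\le\beta_t$. Suppose $R_{A,\underline{\alpha}}(n)=R_{B,\underline{\beta}}(n)$ for every nonnegative integer $n$. Then: (1) For integers $u\ge -a_1$, $v\ge -b_1$, one has $R_{A+u,\underline{\alpha}}(n)=R_{B+v,\underline{\beta}}(n)$ for every nonnegative integer $n$ if and only if there exists $w\in\mathbb{Z}$ with \[u=w\frac{\beta_1+\cdots+\beta_t}{\gcd(\alpha_1+\cdots+\alpha_s,\ \beta_1+\cdots+\beta_t)},\qquad v=w\frac{\alpha_1+\cdots+\alpha_s}{\gcd(\alpha_1+\cdots+\alpha_s,\ \beta_1+\cdots+\beta_t)}.\] (2) $R_{A-a_1,\underline{\alpha}}(n)=R_{B-b_1,\underline{\beta}}(n)$ for every nonnegative integer $n$.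
   Context: For a multiset $A=\{a_1\le a_2\le\cdots\}$ of nonnegative integers (listed with multiplicity) and a vector $\underline{\alpha}=(\alpha_1,\dots,\alpha_s)$ of positive integers, $R_{A,\underline{\alpha}}(n)=|\{(j_1,\dots,j_s): j_i\in\mathbb{Z}^+,\ \sum_{i=1}^s\alpha_i a_{j_i}=n\}|$. For an integer $m$, $A+m$ is the multiset $\{a_i+m\}$ (same multiplicities). -}

module Defs where

open import Data.Nat using (ℕ; zero; suc; _+_; _*_; _≤_; _<_)
open import Data.Nat.Divisibility using (_∣_; quotient)
open import Data.Nat.GCD using (gcd; gcd[m,n]∣m; gcd[m,n]∣n)
open import Data.Integer using (ℤ; +_; ∣_∣) renaming (_+_ to _+ℤ_)
open import Data.Fin using (Fin) renaming (zero to fzero; suc to fsuc)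
open import Data.Product using (Σ; ∃; _×_)
open import Function.Bundles using (_↔_)
open import Relation.Binary.PropositionalEquality using (_≡_)

sumFin : (s : ℕ) → (Fin s → ℕ) → ℕ
sumFin zero    f = 0
sumFin (suc s) f = f fzero + sumFin s (λ i → f (fsuc i))

-- A multiset A = {a_1 ≤ a_2 ≤ ...} is given as a sequence a : ℕ → ℕ
-- (a 0 = a_1, a 1 = a_2, ...).
NonDecreasing : (ℕ → ℕ) → Set
NonDecreasing a = ∀ i j → i ≤ j → a i ≤ a j

FiniteMultiplicity : (ℕ → ℕ) → Set
FiniteMultiplicity a = ∀ m → ∃ λ N → ∀ i → a i ≡ m → i < N

Positive : {s : ℕ} → (Fin s → ℕ) → Set
Positive {s} α = ∀ i → 1 ≤ α i

SortedVec : {s : ℕ} → (Fin s → ℕ) → Set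
SortedVec {s} α = ∀ i j → Data.Fin._≤_ i j → α i ≤ α j
  where import Data.Fin

-- Solutions (j_1,…,j_s) of α_1 a_{j_1} + … + α_s a_{j_s} = n (indices 0-based)
Sol : (ℕ → ℕ) → {s : ℕ} → (Fin s → ℕ) → ℕ → Set
Sol a {s} α n = Σ (Fin s → ℕ) λ j → sumFin s (λ i → α i * a (j i)) ≡ n

-- R_{A,α}(n) = k : the solution set has exactly k elements
HasR : (ℕ → ℕ) → {s : ℕ} → (Fin s → ℕ) → ℕ → ℕ → Set
HasR a α n k = Fin k ↔ Sol a α n

SameR : (ℕ → ℕ) → {s : ℕ} → (Fin s → ℕ) → (ℕ → ℕ) → {t : ℕ} → (Fin t → ℕ) → Set
SameR a α b β = ∀ n → ∃ λ k → HasR a α n k × HasR b β n k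

-- A + u  (only used when all entries stay nonnegative)
shift : (ℕ → ℕ) → ℤ → (ℕ → ℕ)
shift a u i = ∣ (+ a i) +ℤ u ∣

coB : ℕ → ℕ → ℕ
coB m n = quotient (gcd[m,n]∣n m n)

coA : ℕ → ℕ → ℕ
coA m n = quotient (gcd[m,n]∣m m n)

-- Every representation j has value Σα·a(j) ≥ (Σα)·a₀, with equality at j ≡ 0, so
-- (Σα)·a₀ is the least n with R_{A,α}(n) ≠ 0; hence R_{A,α} = R_{B,β} forces
-- (Σα)·a₀ = (Σβ)·b₀. Shifting A by u adds u·Σα to the value of every representation,
-- i.e. R_{A+u,α}(n) = R_{A,α}(n − u·Σα). So R_{A+u,α} = R_{B+v,β} iff u·Σα = v·Σβ:
-- one direction compares least points of the shifted functions, the other shifts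
-- R_{A,α} = R_{B,β} along. Finally u·Σα = v·Σβ iff (u, v) is an integer multiple of
-- (Σβ/g, Σα/g), because these two cofactors are coprime. Part (2) is u = −a₀, v = −b₀.
module Submission where

open import Defs
open import Data.Nat using (ℕ; _≤_)
open import Data.Integer using (ℤ; +_; -_; _*_) renaming (_≤_ to _≤ℤ_)
open import Data.Fin using (Fin)
open import Data.Product using (∃; _×_)
open import Function.Bundles using (_⇔_)
open import Relation.Binary.PropositionalEquality using (_≡_)

import Data.Nat as ℕ
import Data.Nat.Properties as ℕP
import Data.Integer as ℤ
import Data.Integer.Properties as ℤP
import Data.Nat.Divisibility as ℕD
import Data.Nat.Coprimality as Coprimality
import Data.Nat.GCD as GCD
import Data.Integer.Divisibility.Signed as ℤD
open import Algebra.Properties.AbelianGroup ℤP.+-0-abelianGroup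
  using (∙-cancelˡ; ∙-cancelʳ; //-rightDividesˡ)
open import Data.Fin using () renaming (zero to fzero; suc to fsuc)
open import Data.Product using (_,_)
open import Data.Empty using (⊥-elim)
open import Data.Sum using (inj₁)
open import Function.Construct.Composition using (_⇔-∘_)
open import Function.Bundles using (_↔_; Inverse; mk↔ₛ′; mk⇔)
open import Function.Properties.Inverse using (↔-trans; ↔-sym)
open import Relation.Nullary using (¬_)
open import Relation.Binary.PropositionalEquality
  using (refl; sym; trans; cong; cong₂; subst; subst₂; module ≡-Reasoning)
open import Data.Integer.Tactic.RingSolver using (solve-∀)

weightedSum : (ℕ → ℕ) → {s : ℕ} → (Fin s → ℕ) → (Fin s → ℕ) → ℕ
weightedSum a {s} α j = sumFin s (λ i → α i ℕ.* a (j i))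

sumFin-positive : ∀ {s} → 1 ≤ s → (α : Fin s → ℕ) → Positive α → 1 ≤ sumFin s α
sumFin-positive {ℕ.suc s} _ α α>0 = ℕP.≤-trans (α>0 fzero) (ℕP.m≤m+n (α fzero) _)

weightedSum-const : ∀ a {s} (α : Fin s → ℕ) m → weightedSum a α (λ _ → m) ≡ sumFin s α ℕ.* a m
weightedSum-const a {ℕ.zero}  α m = refl
weightedSum-const a {ℕ.suc s} α m = begin
  α fzero ℕ.* a m ℕ.+ weightedSum a (λ i → α (fsuc i)) (λ _ → m)
    ≡⟨ cong (α fzero ℕ.* a m ℕ.+_) (weightedSum-const a (λ i → α (fsuc i)) m) ⟩
  α fzero ℕ.* a m ℕ.+ sumFin s (λ i → α (fsuc i)) ℕ.* a m
    ≡⟨ ℕP.*-distribʳ-+ (a m) (α fzero) _ ⟨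
  sumFin (ℕ.suc s) α ℕ.* a m ∎
  where open ≡-Reasoning

weightedSum-lowerBound : ∀ {a m} → (∀ i → m ≤ a i) → ∀ {s} (α j : Fin s → ℕ)
  → sumFin s α ℕ.* m ≤ weightedSum a α j
weightedSum-lowerBound m≤a {ℕ.zero}  α j = ℕ.z≤n
weightedSum-lowerBound {a} {m} m≤a {ℕ.suc s} α j =
  subst (ℕ._≤ weightedSum a α j) (sym (ℕP.*-distribʳ-+ m (α fzero) _))
    (ℕP.+-mono-≤ (ℕP.*-monoʳ-≤ (α fzero) (m≤a (j fzero)))
                 (weightedSum-lowerBound m≤a (λ i → α (fsuc i)) (λ i → j (fsuc i))))

head-least : ∀ {a} → NonDecreasing a → ∀ i → a 0 ≤ a i
head-least a↑ i = a↑ 0 i ℕ.z≤n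

SameR-sym : ∀ {a b s t} {α : Fin s → ℕ} {β : Fin t → ℕ} → SameR a α b β → SameR b β a α
SameR-sym R n with R n
... | k , ra , rb = k , rb , ra

SameR⇒least-≥ : ∀ {a b s t} (α : Fin s → ℕ) (β : Fin t → ℕ) → (∀ i → b 0 ≤ b i)
  → SameR a α b β → sumFin t β ℕ.* b 0 ≤ sumFin s α ℕ.* a 0
SameR⇒least-≥ {a} {b} {s} {t} α β b₀-least R with R (sumFin s α ℕ.* a 0)
... | k , ra , rb with Inverse.to rb (Inverse.from ra ((λ _ → 0) , weightedSum-const a α 0))
... | j , value≡ = subst (sumFin t β ℕ.* b 0 ≤_) value≡ (weightedSum-lowerBound b₀-least β j)

SameR⇒least-≡ : ∀ {a b s t} (α : Fin s → ℕ) (β : Fin t → ℕ)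
  → (∀ i → a 0 ≤ a i) → (∀ i → b 0 ≤ b i)
  → SameR a α b β → sumFin s α ℕ.* a 0 ≡ sumFin t β ℕ.* b 0
SameR⇒least-≡ {a} {b} α β a₀-least b₀-least R =
  ℕP.≤-antisym (SameR⇒least-≥ {b} {a} β α a₀-least (SameR-sym {a} {b} {α = α} {β = β} R))
               (SameR⇒least-≥ {a} {b} α β b₀-least R)

ShiftNonNeg : (ℕ → ℕ) → ℤ → Set
ShiftNonNeg a u = ∀ i → + 0 ≤ℤ + a i ℤ.+ u

shift-nonneg : ∀ {a} → NonDecreasing a → ∀ {u} → - (+ a 0) ≤ℤ u → ShiftNonNeg a u
shift-nonneg {a} a↑ {u} -a₀≤u i =
  subst (_≤ℤ + a i ℤ.+ u) (ℤP.+-inverseʳ (+ a 0)) (ℤP.+-mono-≤ (ℤ.+≤+ (head-least a↑ i)) -a₀≤u)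

shift-least : ∀ {a} → NonDecreasing a → ∀ {u} → ShiftNonNeg a u → ∀ i → shift a u 0 ≤ shift a u i
shift-least {a} a↑ {u} a+u≥0 i = ℤP.drop‿+≤+
  (subst₂ _≤ℤ_ (sym (ℤP.0≤i⇒+∣i∣≡i (a+u≥0 0))) (sym (ℤP.0≤i⇒+∣i∣≡i (a+u≥0 i)))
    (ℤP.+-monoˡ-≤ u (ℤ.+≤+ (head-least a↑ i))))

+weightedSum-shift : ∀ {a u} → ShiftNonNeg a u → ∀ {s} (α j : Fin s → ℕ)
  → + weightedSum (shift a u) α j ≡ + weightedSum a α j ℤ.+ u * + sumFin s α
+weightedSum-shift {u = u} a+u≥0 {ℕ.zero} α j = sym (trans (ℤP.+-identityˡ _) (ℤP.*-zeroʳ u))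
+weightedSum-shift {a} {u} a+u≥0 {ℕ.suc s} α j = begin
  + (x ℕ.* shift a u (j fzero) ℕ.+ weightedSum (shift a u) α′ j′)
    ≡⟨ ℤP.pos-+ (x ℕ.* shift a u (j fzero)) _ ⟩
  + (x ℕ.* shift a u (j fzero)) ℤ.+ + weightedSum (shift a u) α′ j′
    ≡⟨ cong₂ ℤ._+_ (trans (ℤP.pos-* x (shift a u (j fzero)))
                          (cong (+ x *_) (ℤP.0≤i⇒+∣i∣≡i (a+u≥0 (j fzero)))))
                   (+weightedSum-shift {a} {u} a+u≥0 α′ j′) ⟩
  + x * (+ y ℤ.+ u) ℤ.+ (+ weightedSum a α′ j′ ℤ.+ u * + sumFin s α′)
    ≡⟨ distribute (+ x) (+ y) (+ weightedSum a α′ j′) u (+ sumFin s α′) ⟩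
  (+ x * + y ℤ.+ + weightedSum a α′ j′) ℤ.+ u * (+ x ℤ.+ + sumFin s α′)
    ≡⟨ cong₂ (λ p q → p ℤ.+ u * q)
             (trans (ℤP.pos-+ (x ℕ.* y) (weightedSum a α′ j′))
                    (cong (ℤ._+ + weightedSum a α′ j′) (ℤP.pos-* x y)))
             (ℤP.pos-+ x (sumFin s α′)) ⟨
  + weightedSum a α j ℤ.+ u * + sumFin (ℕ.suc s) α ∎
  where
  open ≡-Reasoning
  x = α fzero
  y = a (j fzero)
  α′ j′ : Fin s → ℕ
  α′ i = α (fsuc i)
  j′ i = j (fsuc i)
  distribute : ∀ (p q r u z : ℤ)
    → p * (q ℤ.+ u) ℤ.+ (r ℤ.+ u * z) ≡ (p * q ℤ.+ r) ℤ.+ u * (p ℤ.+ z)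
  distribute = solve-∀

+least-shift : ∀ {a u} → ShiftNonNeg a u → ∀ {s} (α : Fin s → ℕ)
  → + (sumFin s α ℕ.* shift a u 0) ≡ + (sumFin s α ℕ.* a 0) ℤ.+ u * + sumFin s α
+least-shift {a} {u} a+u≥0 α = begin
  + (sumFin _ α ℕ.* shift a u 0)                ≡⟨ cong +_ (weightedSum-const (shift a u) α 0) ⟨
  + weightedSum (shift a u) α (λ _ → 0)         ≡⟨ +weightedSum-shift {a} {u} a+u≥0 α (λ _ → 0) ⟩
  + weightedSum a α (λ _ → 0) ℤ.+ u * + sumFin _ α
    ≡⟨ cong (λ m → + m ℤ.+ u * + sumFin _ α) (weightedSum-const a α 0) ⟩
  + (sumFin _ α ℕ.* a 0) ℤ.+ u * + sumFin _ α   ∎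
  where open ≡-Reasoning

Sol-shift↔ : ∀ {a u} → ShiftNonNeg a u → ∀ {s} (α : Fin s → ℕ) {m n}
  → + m ℤ.+ u * + sumFin s α ≡ + n → Sol (shift a u) α n ↔ Sol a α m
Sol-shift↔ {a} {u} a+u≥0 α {m} {n} m+c≡n =
  mk↔ₛ′ to from (λ (j , _) → cong (j ,_) (ℕP.≡-irrelevant _ _))
                (λ (j , _) → cong (j ,_) (ℕP.≡-irrelevant _ _))
  where
  c = u * + sumFin _ α
  to : Sol (shift a u) α n → Sol a α m
  to (j , value≡n) = j , ℤP.+-injective (∙-cancelʳ c _ _
    (trans (sym (+weightedSum-shift {a} {u} a+u≥0 α j)) (trans (cong +_ value≡n) (sym m+c≡n))))
  from : Sol a α m → Sol (shift a u) α n
  from (j , value≡m) = j , ℤP.+-injective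
    (trans (+weightedSum-shift {a} {u} a+u≥0 α j) (trans (cong (λ k → + k ℤ.+ c) value≡m) m+c≡n))

Sol-shift-empty : ∀ {a u} → ShiftNonNeg a u → ∀ {s} (α : Fin s → ℕ) {k n}
  → ℤ.-[1+ k ] ℤ.+ u * + sumFin s α ≡ + n → ¬ Sol (shift a u) α n
Sol-shift-empty {a} {u} a+u≥0 {s} α {k} -k+c≡n (j , value≡n)
  with ∙-cancelʳ (u * + sumFin s α) (+ weightedSum a α j) ℤ.-[1+ k ]
  (trans (sym (+weightedSum-shift {a} {u} a+u≥0 α j)) (trans (cong +_ value≡n) (sym -k+c≡n)))
... | ()

Fin0↔ : ∀ {A : Set} → ¬ A → Fin 0 ↔ A
Fin0↔ ¬A = mk↔ₛ′ (λ ()) (λ x → ⊥-elim (¬A x)) (λ x → ⊥-elim (¬A x)) (λ ())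

SameR-shift : ∀ {a b s t} (α : Fin s → ℕ) (β : Fin t → ℕ) {u v}
  → ShiftNonNeg a u → ShiftNonNeg b v
  → u * + sumFin s α ≡ v * + sumFin t β
  → SameR a α b β → SameR (shift a u) α (shift b v) β
SameR-shift {a} {b} {s} {t} α β {u} {v} a+u≥0 b+v≥0 cα≡cβ R n =
  split (+ n ℤ.- u * + sumFin s α) (//-rightDividesˡ (u * + sumFin s α) (+ n))
  where
  via-β : ∀ d → d ℤ.+ u * + sumFin s α ≡ + n → d ℤ.+ v * + sumFin t β ≡ + n
  via-β d d+cα≡n = trans (cong (λ c → d ℤ.+ c) (sym cα≡cβ)) d+cα≡n
  split : ∀ d → d ℤ.+ u * + sumFin s α ≡ + n
    → ∃ λ k → HasR (shift a u) α n k × HasR (shift b v) β n k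
  split (+ m) m+c≡n with R m
  ... | k , ra , rb = k , ↔-trans ra (↔-sym (Sol-shift↔ {a} {u} a+u≥0 α m+c≡n))
                        , ↔-trans rb (↔-sym (Sol-shift↔ {b} {v} b+v≥0 β (via-β (+ m) m+c≡n)))
  split ℤ.-[1+ k ] -k+c≡n =
    0 , Fin0↔ (Sol-shift-empty {a} {u} a+u≥0 α -k+c≡n)
      , Fin0↔ (Sol-shift-empty {b} {v} b+v≥0 β (via-β ℤ.-[1+ k ] -k+c≡n))

SameR-shift-inverse : ∀ {a b s t} (α : Fin s → ℕ) (β : Fin t → ℕ) {u v}
  → NonDecreasing a → NonDecreasing b → ShiftNonNeg a u → ShiftNonNeg b v
  → SameR a α b β → SameR (shift a u) α (shift b v) β
  → u * + sumFin s α ≡ v * + sumFin t β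
SameR-shift-inverse {a} {b} {s} {t} α β {u} {v} a↑ b↑ a+u≥0 b+v≥0 R R′ =
  ∙-cancelˡ (+ (sumFin s α ℕ.* a 0)) _ _ (begin
    + (sumFin s α ℕ.* a 0) ℤ.+ u * + sumFin s α  ≡⟨ +least-shift {a} {u} a+u≥0 α ⟨
    + (sumFin s α ℕ.* shift a u 0)               ≡⟨ cong +_ shifted-least≡ ⟩
    + (sumFin t β ℕ.* shift b v 0)               ≡⟨ +least-shift {b} {v} b+v≥0 β ⟩
    + (sumFin t β ℕ.* b 0) ℤ.+ v * + sumFin t β  ≡⟨ cong (λ x → + x ℤ.+ v * + sumFin t β) least≡ ⟨
    + (sumFin s α ℕ.* a 0) ℤ.+ v * + sumFin t β  ∎)
  where
  open ≡-Reasoning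
  least≡ : sumFin s α ℕ.* a 0 ≡ sumFin t β ℕ.* b 0
  least≡ = SameR⇒least-≡ α β (head-least a↑) (head-least b↑) R
  shifted-least≡ : sumFin s α ℕ.* shift a u 0 ≡ sumFin t β ℕ.* shift b v 0
  shifted-least≡ = SameR⇒least-≡ α β (shift-least a↑ {u} a+u≥0) (shift-least b↑ {v} b+v≥0) R′

coprime-*≡*⇔ : ∀ {p q} → Coprimality.Coprime p q → .{{_ : ℕ.NonZero q}} → (u v : ℤ)
  → (u * + p ≡ v * + q) ⇔ (∃ λ w → (u ≡ w * + q) × (v ≡ w * + p))
coprime-*≡*⇔ {p} {q} p⊥q u v = mk⇔ to from
  where
  open ≡-Reasoning
  to : u * + p ≡ v * + q → ∃ λ w → (u ≡ w * + q) × (v ≡ w * + p)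
  to up≡vq = w , u≡wq , ℤP.*-cancelʳ-≡ v (w * + p) (+ q) (begin
    v * + q        ≡⟨ up≡vq ⟨
    u * + p        ≡⟨ cong (_* + p) u≡wq ⟩
    w * + q * + p  ≡⟨ ℤP.*-assoc w (+ q) (+ p) ⟩
    w * (+ q * + p) ≡⟨ cong (w *_) (ℤP.*-comm (+ q) (+ p)) ⟩
    w * (+ p * + q) ≡⟨ ℤP.*-assoc w (+ p) (+ q) ⟨
    w * + p * + q  ∎)
    where
    q∣p∣u∣ : q ℕD.∣ p ℕ.* ℤ.∣ u ∣
    q∣p∣u∣ = ℕD.divides ℤ.∣ v ∣ (begin
      p ℕ.* ℤ.∣ u ∣     ≡⟨ ℕP.*-comm p ℤ.∣ u ∣ ⟩
      ℤ.∣ u ∣ ℕ.* p     ≡⟨ ℤP.abs-* u (+ p) ⟨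
      ℤ.∣ u * + p ∣     ≡⟨ cong ℤ.∣_∣ up≡vq ⟩
      ℤ.∣ v * + q ∣     ≡⟨ ℤP.abs-* v (+ q) ⟩
      ℤ.∣ v ∣ ℕ.* q     ∎)
    q∣u : + q ℤD.∣ u
    q∣u = ℤD.∣ᵤ⇒∣ (Coprimality.coprime-divisor (Coprimality.sym p⊥q) q∣p∣u∣)
    w = ℤD._∣_.quotient q∣u
    u≡wq = ℤD._∣_.equality q∣u
  from : (∃ λ w → (u ≡ w * + q) × (v ≡ w * + p)) → u * + p ≡ v * + q
  from (w , refl , refl) = begin
    w * + q * + p   ≡⟨ ℤP.*-assoc w (+ q) (+ p) ⟩
    w * (+ q * + p) ≡⟨ cong (w *_) (ℤP.*-comm (+ q) (+ p)) ⟩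
    w * (+ p * + q) ≡⟨ ℤP.*-assoc w (+ p) (+ q) ⟨
    w * + p * + q   ∎

cofactors-coprime : ∀ m n .{{_ : ℕ.NonZero (GCD.gcd m n)}} → Coprimality.Coprime (coA m n) (coB m n)
cofactors-coprime m n = subst₂ Coprimality.Coprime
  (ℕD.n/m≡quotient (GCD.gcd[m,n]∣m m n)) (ℕD.n/m≡quotient (GCD.gcd[m,n]∣n m n))
  (Coprimality.coprime-/gcd m n)

*≡*⇔cofactors-*≡* : ∀ m n (u v : ℤ) .{{_ : ℕ.NonZero (GCD.gcd m n)}}
  → (u * + m ≡ v * + n) ⇔ (u * + coA m n ≡ v * + coB m n)
*≡*⇔cofactors-*≡* m n u v = mk⇔
  (λ um≡vn → ℤP.*-cancelʳ-≡ _ _ (+ g) (trans (sym (split u g∣m)) (trans um≡vn (split v g∣n))))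
  (λ ua≡vb → trans (split u g∣m) (trans (cong (_* + g) ua≡vb) (sym (split v g∣n))))
  where
  open ≡-Reasoning
  g = GCD.gcd m n
  g∣m = GCD.gcd[m,n]∣m m n
  g∣n = GCD.gcd[m,n]∣n m n
  split : ∀ x {k} (g∣k : g ℕD.∣ k) → x * + k ≡ x * + ℕD.quotient g∣k * + g
  split x {k} g∣k = begin
    x * + k                               ≡⟨ cong (λ k → x * + k) (ℕD.m∣n⇒n≡quotient*m g∣k) ⟩
    x * + (ℕD.quotient g∣k ℕ.* g)         ≡⟨ cong (x *_) (ℤP.pos-* (ℕD.quotient g∣k) g) ⟩
    x * (+ ℕD.quotient g∣k * + g)         ≡⟨ ℤP.*-assoc x _ (+ g) ⟨
    x * + ℕD.quotient g∣k * + g           ∎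

*≡*⇔cofactor-multiple : ∀ {m n} → 1 ≤ m → 1 ≤ n → (u v : ℤ)
  → (u * + m ≡ v * + n) ⇔ (∃ λ w → (u ≡ w * + coB m n) × (v ≡ w * + coA m n))
*≡*⇔cofactor-multiple {m} {n} m≥1 n≥1 u v =
  coprime-*≡*⇔ (cofactors-coprime m n) u v ⇔-∘ *≡*⇔cofactors-*≡* m n u v
  where
  instance
    n≢0 : ℕ.NonZero n
    n≢0 = ℕ.>-nonZero n≥1
    g≢0 : ℕ.NonZero (GCD.gcd m n)
    g≢0 = ℕ.≢-nonZero (GCD.gcd[m,n]≢0 m n (inj₁ (ℕP.>⇒≢ m≥1)))
    coB≢0 : ℕ.NonZero (coB m n)
    coB≢0 = ℕD.quotient≢0 (GCD.gcd[m,n]∣n m n)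

theorem1p4 : (a b : ℕ → ℕ) → NonDecreasing a → NonDecreasing b
    → FiniteMultiplicity a → FiniteMultiplicity b
    → (s t : ℕ) → 1 ≤ s → 1 ≤ t
    → (α : Fin s → ℕ) → (β : Fin t → ℕ)
    → Positive α → Positive β → SortedVec α → SortedVec β
    → SameR a α b β
    → ((u v : ℤ) → - (+ a 0) ≤ℤ u → - (+ b 0) ≤ℤ v
    → (SameR (shift a u) α (shift b v) β
    ⇔ (∃ λ (w : ℤ) → (u ≡ w * (+ coB (sumFin s α) (sumFin t β)))
    × (v ≡ w * (+ coA (sumFin s α) (sumFin t β))))))
    × SameR (shift a (- (+ a 0))) α (shift b (- (+ b 0))) β
theorem1p4 a b a↑ b↑ _ _ s t s≥1 t≥1 α β α>0 β>0 _ _ R = shifts , least-shifts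
  where
  Sα = sumFin s α
  Sβ = sumFin t β
  shifts : (u v : ℤ) → - (+ a 0) ≤ℤ u → - (+ b 0) ≤ℤ v
    → SameR (shift a u) α (shift b v) β
      ⇔ (∃ λ w → (u ≡ w * + coB Sα Sβ) × (v ≡ w * + coA Sα Sβ))
  shifts u v -a₀≤u -b₀≤v =
    *≡*⇔cofactor-multiple (sumFin-positive s≥1 α α>0) (sumFin-positive t≥1 β β>0) u v
      ⇔-∘ mk⇔ (SameR-shift-inverse {a} {b} α β {u} {v} a↑ b↑ a+u≥0 b+v≥0 R)
              (λ uSα≡vSβ → SameR-shift {a} {b} α β {u} {v} a+u≥0 b+v≥0 uSα≡vSβ R)
    where
    a+u≥0 : ShiftNonNeg a u
    a+u≥0 = shift-nonneg a↑ -a₀≤u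
    b+v≥0 : ShiftNonNeg b v
    b+v≥0 = shift-nonneg b↑ -b₀≤v
  least≡ : + a 0 * + Sα ≡ + b 0 * + Sβ
  least≡ = begin
    + a 0 * + Sα     ≡⟨ ℤP.pos-* (a 0) Sα ⟨
    + (a 0 ℕ.* Sα)   ≡⟨ cong +_ (ℕP.*-comm (a 0) Sα) ⟩
    + (Sα ℕ.* a 0)   ≡⟨ cong +_ (SameR⇒least-≡ α β (head-least a↑) (head-least b↑) R) ⟩
    + (Sβ ℕ.* b 0)   ≡⟨ cong +_ (ℕP.*-comm Sβ (b 0)) ⟩
    + (b 0 ℕ.* Sβ)   ≡⟨ ℤP.pos-* (b 0) Sβ ⟩
    + b 0 * + Sβ     ∎
    where open ≡-Reasoning
  least-shifts : SameR (shift a (- (+ a 0))) α (shift b (- (+ b 0))) β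
  least-shifts = SameR-shift {a} {b} α β {u = - (+ a 0)} {v = - (+ b 0)}
    (shift-nonneg a↑ ℤP.≤-refl) (shift-nonneg b↑ ℤP.≤-refl)
    (trans (sym (ℤP.neg-distribˡ-* (+ a 0) (+ Sα)))
           (trans (cong -_ least≡) (ℤP.neg-distribˡ-* (+ b 0) (+ Sβ)))) R
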